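{- Let $\mathcal{A}$ be a finite totally ordered alphabet and let $w\in\mathcal{A}^+$ be a non-empty finite word. Then $\min(w)$ is a suffix of $w$, and $\min(w)$ has exactly one occurrence in $w$.
   Context: Words are compared with the lexicographic order induced by the total order on $\mathcal{A}$: $u<v$ iff $u$ is a proper prefix of $v$, or $u=xau'$, $v=xbv'$ with letters $a<b$. For $k\le|w|$, $\min(w|k)$ denotes the lexicographically smallest factor of $w$ of length $k$. Then $\min(w)$ is defined as $\min(w|k)$ where $k$ is maximal such that all $\min(w|j)$, $j=1,\dots,k$, are prefixes of $\min(w|k)$. -}

module Defs where

open import Data.Nat using (ℕ; _+_; _≤_; _<_)
open import Data.List using (List; []; _∷_; length; take; drop; _++_)
open import Data.List.Membership.Propositional using (_∈_)
open import Data.List.Relation.Binary.Lex.Strict using (Lex-<)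
open import Data.Product using (Σ; ∃; _×_)
open import Relation.Binary.PropositionalEquality using (_≡_)
open import Relation.Nullary using (¬_)

Finite : Set → Set
Finite A = Σ (List A) λ xs → ∀ (a : A) → a ∈ xs

module Words {A : Set} (_≺_ : A → A → Set) where

  Word : Set
  Word = List A

  _<lex_ : Word → Word → Set
  _<lex_ = Lex-< _≡_ _≺_

  Prefix : Word → Word → Set
  Prefix u v = ∃ λ s → u ++ s ≡ v

  Suffix : Word → Word → Set
  Suffix u v = ∃ λ p → p ++ u ≡ v

  OccursAt : Word → Word → ℕ → Set
  OccursAt u w i = (i + length u ≤ length w) × (take (length u) (drop i w) ≡ u)

  FactorOfLength : Word → ℕ → Word → Set
  FactorOfLength w k u = (length u ≡ k) × ∃ λ i → OccursAt u w i

  IsMinFactor : Word → ℕ → Word → Set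
  IsMinFactor w k u =
    FactorOfLength w k u × (∀ v → FactorOfLength w k v → ¬ (v <lex u))

  PrefixChain : Word → ℕ → Set
  PrefixChain w k = ∀ j → 1 ≤ j → j ≤ k → ∀ u v →
    IsMinFactor w j u → IsMinFactor w k v → Prefix u v

  IsMin : Word → Word → Set
  IsMin w m = ∃ λ k → (1 ≤ k) × (k ≤ length w) × PrefixChain w k
    × (∀ k′ → k < k′ → k′ ≤ length w → ¬ PrefixChain w k′)
    × IsMinFactor w k m

  UniqueOccurrence : Word → Word → Set
  UniqueOccurrence u w =
    (∃ λ i → OccursAt u w i) × (∀ i j → OccursAt u w i → OccursAt u w j → i ≡ j)

-- Write min(w|k) for the least factor of length k and say that u "extends to
-- length n" in w when u occurs at some position i with i + n ≤ |w|, i.e. u is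
-- a prefix of some factor of length n.  The whole argument rests on one
-- characterisation: for k ≤ n,
--     min(w|k) is a prefix of min(w|n)  iff  min(w|k) extends to length n.
-- (⇐: otherwise the factor of length n starting at that occurrence would beat
-- min(w|n); ⇒: min(w|n) itself is such a factor.)  Hence the prefix chain
-- min(w|1), min(w|2), … grows from k to k + 1 exactly when min(w|k) has an
-- occurrence that is not a suffix occurrence.
--   Existence: starting from k = 1, grow k while min(w|k) extends to k + 1;
--   the first k where it does not is maximal, because a longer chain would
--   make min(w|k) extend to a larger length, hence to k + 1.
--   Suffix and uniqueness: by maximality every occurrence of m = min(w) ends
--   at the end of w, so m is a suffix and all its occurrences coincide.
module Submission where

open import Defs
open import Data.List using (List; []; _∷_; length; take; drop; _++_)
open import Data.List.Properties using (length-take; length-drop; length-++-≤ˡ; take-take; take++drop≡id; take-all; ++-assoc; ++-identityʳ; ≡-dec)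
open import Data.List.Relation.Binary.Lex.Strict using (base; this; next; <-compare; <-transitive)
open import Data.List.Relation.Binary.Pointwise using (Pointwise-≡⇒≡; ≡⇒Pointwise-≡)
open import Data.Nat using (ℕ; zero; suc; _+_; _∸_; _⊓_; _≤_; _<_; z≤n; s≤s; _≤?_)
open import Data.Nat.Properties
open import Data.Product using (∃; _×_; _,_; proj₁)
open import Data.Sum using (inj₁; inj₂)
open import Data.Empty using (⊥-elim)
open import Function using (_∘_)
open import Relation.Binary using (IsStrictTotalOrder; Tri; tri<; tri≈; tri>; Trichotomous; Transitive)
open import Relation.Binary.Consequences using (tri⇒irr)
open import Relation.Binary.PropositionalEquality
open import Relation.Nullary using (¬_; Dec; yes; no; map′)
open import Relation.Nullary.Decidable using (_×-dec_)

take-length-++ : {A : Set} (u s : List A) → take (length u) (u ++ s) ≡ u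
take-length-++ []      s = refl
take-length-++ (a ∷ u) s = cong (a ∷_) (take-length-++ u s)

take-take-≤ : {A : Set} {m n : ℕ} (xs : List A) → m ≤ n → take m (take n xs) ≡ take m xs
take-take-≤ {m = m} {n} xs m≤n = trans (take-take m n xs) (cong (λ l → take l xs) (m≤n⇒m⊓n≡m m≤n))

extend-range : ∀ {P : ℕ → Set} {b} → (∀ j → j ≤ b → P j) → P (suc b) → ∀ j → j ≤ suc b → P j
extend-range below at j j≤1+b with m≤n⇒m<n∨m≡n j≤1+b
... | inj₁ j≤b  = below j (≤-pred j≤b)
... | inj₂ refl = at

module _ {B : Set} {_<_ : B → B → Set}
         (compare : Trichotomous _≡_ _<_) (<-trans : Transitive _<_) where

  minimiser : (f : ℕ → B) (b : ℕ) → ∃ λ i → i ≤ b × (∀ j → j ≤ b → ¬ (f j < f i))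
  minimiser f zero = 0 , z≤n , λ { j z≤n → tri⇒irr compare refl }
  minimiser f (suc b) with minimiser f b
  ... | i , i≤b , i-min with compare (f (suc b)) (f i)
  ... | tri< fb<fi _ _ = suc b , ≤-refl ,
          extend-range (λ j j≤b fj<fb → i-min j j≤b (<-trans fj<fb fb<fi)) (tri⇒irr compare refl)
  ... | tri≈ fb≮fi _ _ = i , m≤n⇒m≤1+n i≤b , extend-range i-min fb≮fi
  ... | tri> fb≮fi _ _ = i , m≤n⇒m≤1+n i≤b , extend-range i-min fb≮fi

module MinimalFactors {A : Set} (_≺_ : A → A → Set) (≺-sto : IsStrictTotalOrder _≡_ _≺_) where
  open Words _≺_
  open IsStrictTotalOrder ≺-sto using (compare; <-resp-≈) renaming (_≟_ to _≟ᴬ_; trans to ≺-trans)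

  lex-compare : Trichotomous _≡_ _<lex_
  lex-compare u v with <-compare sym compare u v
  ... | tri< u<v u≉v v≮u = tri< u<v (u≉v ∘ ≡⇒Pointwise-≡) v≮u
  ... | tri≈ u≮v u≈v v≮u = tri≈ u≮v (Pointwise-≡⇒≡ u≈v) v≮u
  ... | tri> u≮v u≉v v<u = tri> u≮v (u≉v ∘ ≡⇒Pointwise-≡) v<u

  lex-trans : Transitive _<lex_
  lex-trans = <-transitive isEquivalence <-resp-≈ ≺-trans

  -- Between words of equal length the comparison is decided inside them,
  -- so it survives arbitrary continuations.
  lex-++ : ∀ {u u′} s t → length u ≡ length u′ → u <lex u′ → (u ++ s) <lex (u′ ++ t)
  lex-++ {[]}    {[]}     s t _ (base ())
  lex-++ {a ∷ u} {b ∷ u′} s t _ (this a≺b) = this a≺b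
  lex-++ {a ∷ u} {b ∷ u′} s t e (next a≡b u<u′) = next a≡b (lex-++ s t (suc-injective e) u<u′)

  factor : Word → ℕ → ℕ → Word
  factor w k i = take k (drop i w)

  factor-isFactor : ∀ w k i → i + k ≤ length w → FactorOfLength w k (factor w k i)
  factor-isFactor w k i fits = len , i , subst (λ l → i + l ≤ length w) (sym len) fits
                                      , cong (λ l → take l (drop i w)) len
    where
    len : length (factor w k i) ≡ k
    len = trans (length-take k (drop i w))
            (trans (cong (k ⊓_) (length-drop i w))
              (m≤n⇒m⊓n≡m (m+n≤o⇒m≤o∸n k (subst (_≤ length w) (+-comm i k) fits))))

  ExtendsTo : Word → ℕ → Word → Set
  ExtendsTo w n u = ∃ λ i → (i + n ≤ length w) × (factor w (length u) i ≡ u)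

  extendsTo-mono : ∀ {w m n u} → m ≤ n → ExtendsTo w n u → ExtendsTo w m u
  extendsTo-mono m≤n (i , fits , occ) = i , ≤-trans (+-monoʳ-≤ i m≤n) fits , occ

  -- Positions are bounded by |w|, so extendability is decidable.
  extendsTo? : ∀ w n u → Dec (ExtendsTo w n u)
  extendsTo? w n u = map′ (λ (i , _ , ext) → i , ext) from (anyUpTo? at? (suc (length w)))
    where
    at? : ∀ i → Dec ((i + n ≤ length w) × (factor w (length u) i ≡ u))
    at? i = (i + n ≤? length w) ×-dec ≡-dec _≟ᴬ_ (factor w (length u) i) u
    from : ExtendsTo w n u → ∃ λ i → i < suc (length w) × _
    from (i , fits , occ) = i , s≤s (≤-trans (m≤m+n i n) fits) , fits , occ

  prefix-extendsTo : ∀ {w n u v} → FactorOfLength w n v → Prefix u v → ExtendsTo w n u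
  prefix-extendsTo {w} {n} {u} {v} (refl , j , fits , occ) (s , refl) = j , fits , (begin
    take (length u) (drop j w)                        ≡⟨ take-take-≤ (drop j w) (length-++-≤ˡ u) ⟨
    take (length u) (take (length (u ++ s)) (drop j w)) ≡⟨ cong (take (length u)) occ ⟩
    take (length u) (u ++ s)                          ≡⟨ take-length-++ u s ⟩
    u                                                 ∎)
    where open ≡-Reasoning

  minFactor-exists : ∀ w k → k ≤ length w → ∃ (IsMinFactor w k)
  minFactor-exists w k k≤|w| with minimiser lex-compare lex-trans (factor w k) (length w ∸ k)
  ... | i , i≤ , i-min = factor w k i , factor-isFactor w k i (fits i i≤) , least
    where
    fits : ∀ j → j ≤ length w ∸ k → j + k ≤ length w
    fits j j≤ = subst (j + k ≤_) (m∸n+n≡m k≤|w|) (+-monoˡ-≤ k j≤)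
    least : ∀ v → FactorOfLength w k v → ¬ (v <lex factor w k i)
    least v (|v|≡k , j , j-fits , v-occ) v<min =
      i-min j (m+n≤o⇒m≤o∸n j (subst (λ l → j + l ≤ length w) |v|≡k j-fits))
        (subst (_<lex factor w k i) (sym (subst (λ l → factor w l j ≡ v) |v|≡k v-occ)) v<min)

  minFactor-unique : ∀ {w k u v} → IsMinFactor w k u → IsMinFactor w k v → u ≡ v
  minFactor-unique {u = u} {v} (u-fac , u-min) (v-fac , v-min) with lex-compare u v
  ... | tri< u<v _ _ = ⊥-elim (v-min u u-fac u<v)
  ... | tri≈ _ u≡v _ = u≡v
  ... | tri> _ _ v<u = ⊥-elim (u-min v v-fac v<u)

  take-factor : ∀ {w k n v} → k ≤ n → FactorOfLength w n v
              → FactorOfLength w k (take k v)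
  take-factor {w} {k} {v = v} k≤n (refl , j , j-fits , v-occ) =
    subst (FactorOfLength w k) p-factor
      (factor-isFactor w k j (≤-trans (+-monoʳ-≤ j k≤n) j-fits))
    where
    p-factor : factor w k j ≡ take k v
    p-factor = trans (sym (take-take-≤ (drop j w) k≤n)) (cong (take k) v-occ)

  -- Compare u = min(w|k) with the first k letters p of
  -- v = min(w|n): p is a factor of length k, so p ≮ u; and u < p would make
  -- the length-n factor x beginning with u smaller than v.
  min-prefix-of-min : ∀ {w k n u v} → k ≤ n → IsMinFactor w k u → IsMinFactor w n v
                    → ExtendsTo w n u → Prefix u v
  min-prefix-of-min {w} {k} {n} {u} {v} k≤n ((|u|≡k , _) , u-min) (v-fac , v-min)
                    (i , i-fits , u-occ) = by-cases (lex-compare u p)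
    where
    p = take k v
    p-isFactor : FactorOfLength w k p
    p-isFactor = take-factor k≤n v-fac
    x = factor w n i
    x-starts-with-u : take k x ≡ u
    x-starts-with-u = trans (take-take-≤ (drop i w) k≤n)
                            (subst (λ l → factor w l i ≡ u) |u|≡k u-occ)
    by-cases : Tri (u <lex p) (u ≡ p) (p <lex u) → Prefix u v
    by-cases (tri< u<p _ _) = ⊥-elim (v-min x (factor-isFactor w n i i-fits) x<v)
      where
      x<v : x <lex v
      x<v = subst₂ _<lex_ (trans (cong (_++ drop k x) (sym x-starts-with-u)) (take++drop≡id k x))
                          (take++drop≡id k v)
                          (lex-++ (drop k x) (drop k v) (trans |u|≡k (sym (proj₁ p-isFactor))) u<p)
    by-cases (tri≈ _ u≡p _) = drop k v , trans (cong (_++ drop k v) u≡p) (take++drop≡id k v)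
    by-cases (tri> _ _ p<u) = ⊥-elim (u-min p p-isFactor p<u)

  extendsTo-bound : ∀ {w n u} → ExtendsTo w n u → n ≤ length w
  extendsTo-bound (i , fits , _) = m+n≤o⇒n≤o i fits

  prefix-trans : ∀ {x u v} → Prefix x u → Prefix u v → Prefix x v
  prefix-trans {x} (s , refl) (t , refl) = s ++ t , sym (++-assoc x s t)

  minFactor-prefix : ∀ {w k u v} → IsMinFactor w k u → IsMinFactor w k v → Prefix u v
  minFactor-prefix {u = u} u-min v-min = [] , trans (++-identityʳ u) (minFactor-unique u-min v-min)

  chain-start : ∀ w → PrefixChain w 1
  chain-start w j 1≤j j≤1 u v u-min v-min with ≤-antisym j≤1 1≤j
  ... | refl = minFactor-prefix u-min v-min

  chain-step : ∀ {w k u} → PrefixChain w k → IsMinFactor w k u → ExtendsTo w (suc k) u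
             → PrefixChain w (suc k)
  chain-step {k = k} chain u-min ext j 1≤j j≤1+k x v x-min v-min with m≤n⇒m<n∨m≡n j≤1+k
  ... | inj₁ j≤k  = prefix-trans (chain j 1≤j (≤-pred j≤k) x _ x-min u-min)
                                 (min-prefix-of-min (n≤1+n k) u-min v-min ext)
  ... | inj₂ refl = minFactor-prefix x-min v-min

  chain-extends : ∀ {w k n u} → 1 ≤ k → k < n → n ≤ length w → PrefixChain w n
                → IsMinFactor w k u → ExtendsTo w (suc k) u
  chain-extends {w} {k} {n} {u} 1≤k k<n n≤|w| chain u-min with minFactor-exists w n n≤|w|
  ... | v , v-min = extendsTo-mono k<n
                      (prefix-extendsTo (proj₁ v-min) (chain k 1≤k (<⇒≤ k<n) u v u-min v-min))

  chain-stops⇒isMin : ∀ {w k u} → 1 ≤ k → k ≤ length w → PrefixChain w k → IsMinFactor w k u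
                    → ¬ ExtendsTo w (suc k) u → IsMin w u
  chain-stops⇒isMin 1≤k k≤|w| chain u-min stuck =
    _ , 1≤k , k≤|w| , chain , (λ n k<n n≤|w| chain-n → stuck (chain-extends 1≤k k<n n≤|w| chain-n u-min))
    , u-min

  -- Grow the chain until it stops; d = |w| - k bounds the remaining steps.
  grow-chain : ∀ w d k → k + d ≡ length w → 1 ≤ k → PrefixChain w k → ∃ (IsMin w)
  grow-chain w zero k k+0≡|w| 1≤k chain with minFactor-exists w k (subst (k ≤_) k+0≡|w| (m≤m+n k 0))
  ... | u , u-min = u , chain-stops⇒isMin 1≤k (subst (k ≤_) k+0≡|w| (m≤m+n k 0)) chain u-min no-room
    where
    no-room : ¬ ExtendsTo w (suc k) u
    no-room ext = 1+n≰n (subst (suc k ≤_) (trans (sym k+0≡|w|) (+-identityʳ k)) (extendsTo-bound ext))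
  grow-chain w (suc d) k k+d≡|w| 1≤k chain with minFactor-exists w k (subst (k ≤_) k+d≡|w| (m≤m+n k (suc d)))
  ... | u , u-min with extendsTo? w (suc k) u
  ...   | yes ext   = grow-chain w d (suc k) (trans (sym (+-suc k d)) k+d≡|w|) (s≤s z≤n)
                                 (chain-step chain u-min ext)
  ...   | no  stuck = u , chain-stops⇒isMin 1≤k (subst (k ≤_) k+d≡|w| (m≤m+n k (suc d))) chain u-min stuck

  min-exists : ∀ w → ¬ (w ≡ []) → ∃ (IsMin w)
  min-exists []      w≢[] = ⊥-elim (w≢[] refl)
  min-exists (a ∷ w) _    = grow-chain (a ∷ w) (length w) 1 refl (s≤s z≤n) (chain-start (a ∷ w))

  -- By maximality of the chain, every occurrence of min(w) ends at the end of w.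
  min-occurrence-ends : ∀ {w m i} → IsMin w m → OccursAt m w i → i + length m ≡ length w
  min-occurrence-ends {w} {m} {i} (k , _ , _ , chain , maximal , m-min@((refl , _) , _)) (fits , occ)
    with m≤n⇒m<n∨m≡n fits
  ... | inj₂ ends = ends
  ... | inj₁ room = ⊥-elim (maximal (suc k) ≤-refl (extendsTo-bound ext) (chain-step chain m-min ext))
    where
    ext : ExtendsTo w (suc k) m
    ext = i , subst (_≤ length w) (sym (+-suc i k)) room , occ

  final-occurrence⇒suffix : ∀ {w u i} → OccursAt u w i → i + length u ≡ length w → Suffix u w
  final-occurrence⇒suffix {w} {u} {i} (_ , occ) ends = take i w , (begin
    take i w ++ u                          ≡⟨ cong (take i w ++_) occ ⟨
    take i w ++ take (length u) (drop i w) ≡⟨ cong (take i w ++_) (take-all (length u) (drop i w) rest≤) ⟩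
    take i w ++ drop i w                   ≡⟨ take++drop≡id i w ⟩
    w                                      ∎)
    where
    open ≡-Reasoning
    rest≤ : length (drop i w) ≤ length u
    rest≤ = ≤-reflexive (trans (length-drop i w)
              (trans (cong (_∸ i) (sym ends)) (m+n∸m≡n i (length u))))

  min-suffix : ∀ {w m} → IsMin w m → Suffix m w
  min-suffix m-isMin@(_ , _ , _ , _ , _ , (_ , _ , occ) , _) =
    final-occurrence⇒suffix occ (min-occurrence-ends m-isMin occ)

  min-unique-occurrence : ∀ {w m} → IsMin w m → UniqueOccurrence m w
  min-unique-occurrence {m = m} m-isMin@(_ , _ , _ , _ , _ , (_ , first) , _) =
    first , λ i j i-occ j-occ → +-cancelʳ-≡ (length m) i j
                                  (trans (min-occurrence-ends m-isMin i-occ)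
                                         (sym (min-occurrence-ends m-isMin j-occ)))

proposition4p3 : {A : Set} (_≺_ : A → A → Set) → IsStrictTotalOrder _≡_ _≺_ → Finite A →
    (w : List A) → ¬ (w ≡ []) →
      (∃ λ m → Words.IsMin _≺_ w m)
      × (∀ m → Words.IsMin _≺_ w m → Words.Suffix _≺_ m w × Words.UniqueOccurrence _≺_ m w)
proposition4p3 _≺_ ≺-sto _ w w≢[] =
  min-exists w w≢[] , λ m m-isMin → min-suffix m-isMin , min-unique-occurrence m-isMin
  where open MinimalFactors _≺_ ≺-sto
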